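{- Let $\varphi$ be a finite conjunction of atomic formulas in the signature of $\mathfrak Q$. Let $\varphi_<$ be the conjunction of the conjuncts of $\varphi$ formed with the symbol $<$, for each prime $p$ let $\varphi_p$ be the conjunction of the conjuncts formed with symbols from $\tau_p$, and let $\varphi_=$ be the conjunction of the conjuncts formed with $=$. Then $\varphi$ is satisfiable in $\mathfrak Q$ if and only if $\varphi_=\wedge\varphi_<$ is satisfiable in $\mathfrak Q$ and $\varphi_=\wedge\varphi_p$ is satisfiable in $\mathfrak Q$ for each prime $p$.
   Context: For a prime $p$, $v_p$ is the $p$-adic valuation on $\mathbb{Q}$ ($v_p(0)=\infty$), and $\tau_p=\{\leq^p_c,\geq^p_c,=^p_c,\neq^p_c: c\in\mathbb{Z}\}$ are unary relation symbols interpreted on $\mathbb{Q}$ as $\{x: v_p(x)\leq c\}$, $\{x: v_p(x)\geq c\}$, $\{x: v_p(x)=c\}$, $\{x: v_p(x)\neq c\}$. $\mathfrak Q$ is the structure with domain $\mathbb{Q}$, binary function $+$, constant $1$, the strict order $<$, and all relations from $\tau_p$ for all primes $p$. Atomic formulas are built from variables, $+$, $1$, $=$ and these relation symbols. -}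

module Defs where

open import Data.Nat as ℕ using (ℕ; zero; suc; _≟_)
open import Data.Nat.DivMod using (_/_; _%_)
open import Data.Nat.Primality using (Prime)
open import Data.Integer as ℤ using (ℤ; +_)
open import Data.Rational as ℚ using (ℚ; ↥_; ↧ₙ_; 1ℚ)
open import Data.Maybe using (Maybe; just; nothing)
open import Data.List using (List; []; _∷_)
open import Data.List.Relation.Unary.All using (All)
open import Data.Product using (Σ; _×_)
open import Data.Empty using (⊥)
open import Data.Unit using (⊤)
open import Relation.Nullary using (¬_; yes; no)
open import Relation.Binary.PropositionalEquality using (_≡_)

-- vpFuel k p n : number of times p divides n (for p ≥ 2, n ≠ 0),
-- computed with fuel k (fuel n suffices since n / p < n).
vpFuel : ℕ → ℕ → ℕ → ℕ
vpFuel zero _ _ = 0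
vpFuel (suc k) zero _ = 0
vpFuel (suc k) (suc zero) _ = 0
vpFuel (suc k) (suc (suc q)) zero = 0
vpFuel (suc k) (suc (suc q)) (suc m) with (suc m) % (suc (suc q)) ≟ 0
... | yes _ = suc (vpFuel k (suc (suc q)) (suc m / suc (suc q)))
... | no _  = 0

vpℕ : ℕ → ℕ → ℕ
vpℕ p n = vpFuel n p n

-- ℤ ∪ {∞}: nothing represents ∞
ℤ∞ : Set
ℤ∞ = Maybe ℤ

vp : ℕ → ℚ → ℤ∞
vp p x with ℤ.∣ ↥ x ∣
... | zero  = nothing
... | suc a = just ((+ vpℕ p (suc a)) ℤ.- (+ vpℕ p (↧ₙ x)))

data VRel : Set where
  le ge eqv neq : VRel

⟦_⟧V : VRel → ℤ → ℤ∞ → Set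
⟦ le  ⟧V c nothing  = ⊥
⟦ le  ⟧V c (just v) = v ℤ.≤ c
⟦ ge  ⟧V c nothing  = ⊤
⟦ ge  ⟧V c (just v) = c ℤ.≤ v
⟦ eqv ⟧V c nothing  = ⊥
⟦ eqv ⟧V c (just v) = v ≡ c
⟦ neq ⟧V c nothing  = ⊤
⟦ neq ⟧V c (just v) = ¬ (v ≡ c)

data Term : Set where
  var  : ℕ → Term
  one  : Term
  _⊕_  : Term → Term → Term

data Atom : Set where
  _≐_   : Term → Term → Atom
  _≺_   : Term → Term → Atom
  vrel  : (p : ℕ) → Prime p → VRel → ℤ → Term → Atom

Conj : Set
Conj = List Atom

Assignment : Set
Assignment = ℕ → ℚ

eval : Assignment → Term → ℚ
eval ρ (var i) = ρ i
eval ρ one = 1ℚ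
eval ρ (t ⊕ s) = eval ρ t ℚ.+ eval ρ s

HoldsAtom : Assignment → Atom → Set
HoldsAtom ρ (t ≐ s) = eval ρ t ≡ eval ρ s
HoldsAtom ρ (t ≺ s) = eval ρ t ℚ.< eval ρ s
HoldsAtom ρ (vrel p _ r c t) = ⟦ r ⟧V c (vp p (eval ρ t))

Satisfiable : Conj → Set
Satisfiable φ = Σ Assignment (λ ρ → All (HoldsAtom ρ) φ)

eqPart : Conj → Conj
eqPart [] = []
eqPart ((t ≐ s) ∷ φ) = (t ≐ s) ∷ eqPart φ
eqPart (_ ∷ φ) = eqPart φ

ltPart : Conj → Conj
ltPart [] = []
ltPart ((t ≺ s) ∷ φ) = (t ≺ s) ∷ ltPart φ
ltPart (_ ∷ φ) = ltPart φ

pPart : ℕ → Conj → Conj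
pPart p [] = []
pPart p (vrel q pr r c t ∷ φ) with p ≟ q
... | yes _ = vrel q pr r c t ∷ pPart p φ
... | no _  = pPart p φ
pPart p (_ ∷ φ) = pPart p φ

-- A solution ρ of φ_= ∧ φ_< is turned into a solution of φ by absorbing the primes of φ one at
-- a time.  Given σ solving φ_= ∧ φ_p, every ρ + λ(σ − ρ) still solves the linear equations φ_=.
-- The strict inequalities of φ_< are open in ℝ, and each condition v_q(t) ⋈ c is open in ℚ_q:
-- by the ultrametric inequality, a condition satisfied by x is still satisfied by x + y once
-- v_q(y) is large enough.  So a weight λ that is small in ℝ and in ℚ_q for the primes q absorbed
-- so far keeps φ_< and every φ_q from ρ, and if moreover 1 − λ is small in ℚ_p, φ_p comes from σ.
-- Such weights exist by weak approximation for ℚ.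
module Submission where

open import Defs
open import Data.Nat as ℕ using (ℕ; zero; suc; NonZero; NonTrivial)
open import Data.Nat.Primality using (Prime; prime⇒nonTrivial)
open import Data.Integer as ℤ using (ℤ; +_)
open import Data.Rational as ℚ using (ℚ; 1ℚ)
open import Data.List using (List; []; _∷_; _++_)
open import Data.List.Membership.Propositional using (_∉_)
open import Data.List.Membership.DecPropositional ℕ._≟_ using (_∈?_)
open import Data.List.Relation.Unary.All as All using (All; []; _∷_)
open import Data.List.Relation.Unary.All.Properties using (++⁺; ++⁻ˡ; ++⁻ʳ)
open import Data.List.Relation.Binary.Sublist.Propositional using (_⊆_; []; _∷_; _∷ʳ_)
open import Data.List.Relation.Binary.Sublist.Propositional.Properties using (All-resp-⊆)
open import Data.Product using (∃-syntax; _×_; _,_; proj₁; proj₂)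
open import Data.Sum using (inj₁; inj₂; [_,_]′)
open import Function using (_∘_)
open import Function.Bundles using (_⇔_; mk⇔)
open import Relation.Nullary using (¬_; yes; no; contradiction)
open import Relation.Nullary.Construct.Add.Supremum using (_⁺; ⊤⁺; [_])
open import Relation.Binary.Construct.Add.Supremum.Strict ℤ._<_ using (_<⁺_; [_]; [_]<⊤⁺)
open import Relation.Binary.PropositionalEquality

module NatValuation where

  open import Data.Nat using (_+_; _*_; _^_; _≤_; s≤s; z≤n)
  open import Data.Nat.Properties
  open import Algebra.Properties.CommutativeSemigroup *-commutativeSemigroup
    using () renaming (interchange to *-interchange)
  open import Data.Nat.Divisibility
  open import Data.Nat.DivMod using (_/_; _%_; m/n<m; m≥n⇒m/n>0)
  open import Data.Nat.Primality using (euclidsLemma; prime⇒irreducible; ¬prime[1])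
  import Data.Integer.Divisibility.Signed as ℤD
  open import Relation.Binary.Definitions using (tri<; tri≈; tri>)

  ^-monoʳ-∣ : ∀ p {m n} → m ≤ n → p ^ m ∣ p ^ n
  ^-monoʳ-∣ p {m} m≤n with m≤n⇒∃[o]m+o≡n m≤n
  ... | o , refl = divides (p ^ o) (trans (^-distribˡ-+-* p m o) (*-comm (p ^ m) (p ^ o)))

  ^-monoˡ-∣ : ∀ k {m n} → m ∣ n → m ^ k ∣ n ^ k
  ^-monoˡ-∣ zero    m∣n = ∣-refl
  ^-monoˡ-∣ (suc k) m∣n = *-pres-∣ m∣n (^-monoˡ-∣ k m∣n)

  prime∤1 : ∀ {q} → Prime q → ¬ q ∣ 1
  prime∤1 q-prime q∣1 = ¬prime[1] (subst Prime (∣1⇒≡1 q∣1) q-prime)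

  prime∣^⇒∣ : ∀ {q m} → Prime q → ∀ k → q ∣ m ^ k → q ∣ m
  prime∣^⇒∣ q-prime zero q∣1 = contradiction q∣1 (prime∤1 q-prime)
  prime∣^⇒∣ {m = m} q-prime (suc k) q∣m*m^k with euclidsLemma m (m ^ k) q-prime q∣m*m^k
  ... | inj₁ q∣m   = q∣m
  ... | inj₂ q∣m^k = prime∣^⇒∣ q-prime k q∣m^k

  prime∣prime⇒≡ : ∀ {q p} → Prime q → Prime p → q ∣ p → q ≡ p
  prime∣prime⇒≡ q-prime p-prime q∣p with prime⇒irreducible p-prime q∣p
  ... | inj₁ refl = contradiction ∣-refl (prime∤1 q-prime)
  ... | inj₂ q≡p  = q≡p

  p^vpFuel∣ : ∀ f p n → p ^ vpFuel f p n ∣ n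
  p^vpFuel∣ zero    p                n = 1∣ n
  p^vpFuel∣ (suc f) zero             n = 1∣ n
  p^vpFuel∣ (suc f) (suc zero)       n = 1∣ n
  p^vpFuel∣ (suc f) (suc (suc q)) zero = 1∣ 0
  p^vpFuel∣ (suc f) p@(suc (suc q)) n@(suc m) with n % p ℕ.≟ 0
  ... | yes n%p≡0 = m∣n/o⇒o*m∣n (m%n≡0⇒n∣m n p n%p≡0) (p^vpFuel∣ f p (n / p))
  ... | no  _     = 1∣ n

  p^1+vpFuel∤ : ∀ f p .{{_ : NonTrivial p}} n .{{_ : NonZero n}} → n ≤ f →
                ¬ p ^ suc (vpFuel f p n) ∣ n
  p^1+vpFuel∤ (suc f) p@(suc (suc q)) n@(suc m) (s≤s m≤f) with n % p ℕ.≟ 0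
  ... | yes n%p≡0 = λ p^2+v∣n →
          p^1+vpFuel∤ f p (n / p) {{n/p≢0}} n/p≤f (m*n∣o⇒n∣o/m p _ p^2+v∣n)
    where
    n/p≢0 : NonZero (n / p)
    n/p≢0 = ℕ.>-nonZero (m≥n⇒m/n>0 (∣⇒≤ (m%n≡0⇒n∣m n p n%p≡0)))
    n/p≤f : n / p ≤ f
    n/p≤f = ≤-pred (≤-trans (m/n<m n p (s≤s (s≤s z≤n))) (s≤s m≤f))
  ... | no  n%p≢0 = λ p∣n → n%p≢0 (n∣m⇒m%n≡0 n p (m*n∣⇒m∣ p 1 p∣n))

  module _ {p : ℕ} .{{_ : NonTrivial p}} where

    p^vpℕ∣ : ∀ n → p ^ vpℕ p n ∣ n
    p^vpℕ∣ n = p^vpFuel∣ n p n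

    p^1+vpℕ∤ : ∀ n .{{_ : NonZero n}} → ¬ p ^ suc (vpℕ p n) ∣ n
    p^1+vpℕ∤ n = p^1+vpFuel∤ n p n ≤-refl

    p^k∣⇒k≤vpℕ : ∀ {k} n .{{_ : NonZero n}} → p ^ k ∣ n → k ≤ vpℕ p n
    p^k∣⇒k≤vpℕ {k} n p^k∣n with k ℕ.≤? vpℕ p n
    ... | yes k≤v = k≤v
    ... | no  k≰v = contradiction (∣-trans (^-monoʳ-∣ p (≰⇒> k≰v)) p^k∣n) (p^1+vpℕ∤ n)

    vpℕ-unique : ∀ {k n} → p ^ k ∣ n → ¬ p ^ suc k ∣ n → vpℕ p n ≡ k
    vpℕ-unique {k} {zero}      _     p^1+k∤0 = contradiction ((p ^ suc k) ∣0) p^1+k∤0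
    vpℕ-unique {k} {n@(suc _)} p^k∣n p^1+k∤n with <-cmp (vpℕ p n) k
    ... | tri< v<k _ _ = contradiction (∣-trans (^-monoʳ-∣ p v<k) p^k∣n) (p^1+vpℕ∤ n)
    ... | tri≈ _ v≡k _ = v≡k
    ... | tri> _ _ k<v = contradiction (∣-trans (^-monoʳ-∣ p k<v) (p^vpℕ∣ n)) p^1+k∤n

    p∤⇒vpℕ≡0 : ∀ {m} → ¬ p ∣ m → vpℕ p m ≡ 0
    p∤⇒vpℕ≡0 {m} p∤m = vpℕ-unique (1∣ m) (p∤m ∘ subst (_∣ m) (*-identityʳ p))

    vpℕ-∣+∣ : ∀ m n .{{_ : ℤ.NonZero m}} → p ^ suc (vpℕ p ℤ.∣ m ∣) ∣ ℤ.∣ n ∣ →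
              ℤ.NonZero (m ℤ.+ n) × vpℕ p ℤ.∣ m ℤ.+ n ∣ ≡ vpℕ p ℤ.∣ m ∣
    vpℕ-∣+∣ m n p^1+k∣n = m+n≢0 , vpℕ-unique (ℤD.∣⇒∣ᵤ P∣m+n) (P′∤m+n ∘ ℤD.∣ᵤ⇒∣ {i = m ℤ.+ n})
      where
      k : ℕ
      k = vpℕ p ℤ.∣ m ∣
      P P′ : ℤ
      P  = + p ^ k
      P′ = + p ^ suc k
      P′∣n : P′ ℤD.∣ n
      P′∣n = ℤD.∣ᵤ⇒∣ {i = n} p^1+k∣n
      P∣m+n : P ℤD.∣ m ℤ.+ n
      P∣m+n = ℤD.∣m∣n⇒∣m+n (ℤD.∣ᵤ⇒∣ {i = m} (p^vpℕ∣ ℤ.∣ m ∣))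
                           (ℤD.∣-trans (ℤD.∣ᵤ⇒∣ {P} {P′} (^-monoʳ-∣ p (n≤1+n k))) P′∣n)
      P′∤m+n : ¬ P′ ℤD.∣ m ℤ.+ n
      P′∤m+n P′∣m+n = p^1+vpℕ∤ ℤ.∣ m ∣ (ℤD.∣⇒∣ᵤ (ℤD.∣m+n∣n⇒∣m {m = m} P′∣m+n P′∣n))
      m+n≢0 : ℤ.NonZero (m ℤ.+ n)
      m+n≢0 = ℕ.≢-nonZero λ ∣m+n∣≡0 →
        P′∤m+n (ℤD.∣ᵤ⇒∣ {i = m ℤ.+ n} (subst (p ^ suc k ∣_) (sym ∣m+n∣≡0) (_ ∣0)))

  module _ {p : ℕ} (p-prime : Prime p) where

    private instance
      p-nonTrivial : NonTrivial p
      p-nonTrivial = prime⇒nonTrivial p-prime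

    vpℕ-* : ∀ a b .{{_ : NonZero a}} .{{_ : NonZero b}} → vpℕ p (a * b) ≡ vpℕ p a + vpℕ p b
    vpℕ-* a b with p^vpℕ∣ a | p^vpℕ∣ b
    ... | divides a′ a≡a′p^i | divides b′ b≡b′p^j = vpℕ-unique p^i+j∣ab p^1+i+j∤ab
      where
      i j : ℕ
      i = vpℕ p a
      j = vpℕ p b
      instance
        p^i+j≢0 : NonZero (p ^ (i + j))
        p^i+j≢0 = m^n≢0 p (i + j) {{ℕ.nonTrivial⇒nonZero p}}
      ab≡ : a * b ≡ (a′ * b′) * p ^ (i + j)
      ab≡ = begin
        a * b                        ≡⟨ cong₂ _*_ a≡a′p^i b≡b′p^j ⟩
        (a′ * p ^ i) * (b′ * p ^ j)  ≡⟨ *-interchange a′ (p ^ i) b′ (p ^ j) ⟩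
        (a′ * b′) * (p ^ i * p ^ j)  ≡⟨ cong ((a′ * b′) *_) (^-distribˡ-+-* p i j) ⟨
        (a′ * b′) * p ^ (i + j)      ∎
        where open ≡-Reasoning
      p^i+j∣ab : p ^ (i + j) ∣ a * b
      p^i+j∣ab = subst (_∣ a * b) (sym (^-distribˡ-+-* p i j)) (*-pres-∣ (p^vpℕ∣ a) (p^vpℕ∣ b))
      p∤a′ : ¬ p ∣ a′
      p∤a′ p∣a′ = p^1+vpℕ∤ a (subst (p ^ suc i ∣_) (sym a≡a′p^i) (*-monoˡ-∣ (p ^ i) p∣a′))
      p∤b′ : ¬ p ∣ b′
      p∤b′ p∣b′ = p^1+vpℕ∤ b (subst (p ^ suc j ∣_) (sym b≡b′p^j) (*-monoˡ-∣ (p ^ j) p∣b′))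
      p^1+i+j∤ab : ¬ p ^ suc (i + j) ∣ a * b
      p^1+i+j∤ab p^1+i+j∣ab = [ p∤a′ , p∤b′ ]′ (euclidsLemma a′ b′ p-prime p∣a′b′)
        where
        p∣a′b′ : p ∣ a′ * b′
        p∣a′b′ = *-cancelʳ-∣ (p ^ (i + j)) (subst (p ^ suc (i + j) ∣_) ab≡ p^1+i+j∣ab)

open NatValuation

module FractionValuation where

  open import Data.Integer using (_+_; _-_; _*_; _<_; _≤_)
  open import Data.Nat.Divisibility using (_∣_; ∣-trans; _∣0)
  import Data.Nat.Properties as ℕP
  import Data.Integer.Properties as ℤP
  open import Data.Integer.Tactic.RingSolver using (solve-∀)
  open import Data.Rational using (toℚᵘ; 0ℚ)
  import Data.Rational.Properties as ℚP
  open import Data.Rational.Unnormalised as ℚᵘ using (ℚᵘ; mkℚᵘ; *≡*)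
  open import Data.Maybe using (zipWith)

  i≤+∣i∣ : ∀ i → i ≤ + ℤ.∣ i ∣
  i≤+∣i∣ (+ _)      = ℤP.≤-refl
  i≤+∣i∣ ℤ.-[1+ _ ] = ℤ.-≤+

  pos-diff-≡ : ∀ a b c d → a ℕ.+ d ≡ c ℕ.+ b → + a - + b ≡ + c - + d
  pos-diff-≡ a b c d a+d≡c+b = begin
    + a - + b                   ≡⟨ shift (+ a) (+ b) (+ d) ⟩
    (+ a + + d) - (+ b + + d)   ≡⟨ cong (_- (+ b + + d)) (ℤP.pos-+ a d) ⟨
    + (a ℕ.+ d) - (+ b + + d)   ≡⟨ cong (λ x → + x - (+ b + + d)) a+d≡c+b ⟩
    + (c ℕ.+ b) - (+ b + + d)   ≡⟨ cong (_- (+ b + + d)) (ℤP.pos-+ c b) ⟩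
    (+ c + + b) - (+ b + + d)   ≡⟨ shift′ (+ c) (+ b) (+ d) ⟨
    + c - + d                   ∎
    where
    open ≡-Reasoning
    shift : ∀ x y z → x - y ≡ (x + z) - (y + z)
    shift = solve-∀
    shift′ : ∀ x y z → x - z ≡ (x + y) - (y + z)
    shift′ = solve-∀

  pos-diff-< : ∀ a b c d → + a - + b < + c - + d → a ℕ.+ d ℕ.< c ℕ.+ b
  pos-diff-< a b c d lt = ℤP.drop‿+<+ (begin-strict
    + (a ℕ.+ d)                ≡⟨ ℤP.pos-+ a d ⟩
    + a + + d                  ≡⟨ shift (+ a) (+ b) (+ d) ⟩
    (+ a - + b) + (+ b + + d)  <⟨ ℤP.+-monoˡ-< (+ b + + d) lt ⟩
    (+ c - + d) + (+ b + + d)  ≡⟨ shift′ (+ c) (+ b) (+ d) ⟩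
    + c + + b                  ≡⟨ ℤP.pos-+ c b ⟨
    + (c ℕ.+ b)                ∎)
    where
    open ℤP.≤-Reasoning
    shift : ∀ x y z → x + z ≡ (x - y) + (y + z)
    shift = solve-∀
    shift′ : ∀ x y z → (x - z) + (y + z) ≡ x + y
    shift′ = solve-∀

  pos-diff-+ : ∀ a b c d → + (a ℕ.+ c) - + (b ℕ.+ d) ≡ (+ a - + b) + (+ c - + d)
  pos-diff-+ a b c d = begin
    + (a ℕ.+ c) - + (b ℕ.+ d)  ≡⟨ cong₂ _-_ (ℤP.pos-+ a c) (ℤP.pos-+ b d) ⟩
    (+ a + + c) - (+ b + + d)  ≡⟨ regroup (+ a) (+ b) (+ c) (+ d) ⟩
    (+ a - + b) + (+ c - + d)  ∎
    where
    open ≡-Reasoning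
    regroup : ∀ x y z w → (x + z) - (y + w) ≡ (x - y) + (z - w)
    regroup = solve-∀

  vpFrac : ℕ → ℕ → ℕ → ℤ ⁺
  vpFrac p zero      d = ⊤⁺
  vpFrac p a@(suc _) d = [ + vpℕ p a - + vpℕ p d ]

  vpᵘ : ℕ → ℚᵘ → ℤ ⁺
  vpᵘ p x = vpFrac p ℤ.∣ ℚᵘ.↥ x ∣ (ℚᵘ.↧ₙ x)

  vp≡vpᵘ : ∀ p x → vp p x ≡ vpᵘ p (toℚᵘ x)
  vp≡vpᵘ p (ℚ.mkℚ (+ zero)     _ _) = refl
  vp≡vpᵘ p (ℚ.mkℚ (+ suc _)    _ _) = refl
  vp≡vpᵘ p (ℚ.mkℚ ℤ.-[1+ _ ] _ _) = refl

  vp≡⊤⁺⇒≡0 : ∀ p x → vp p x ≡ ⊤⁺ → x ≡ 0ℚ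
  vp≡⊤⁺⇒≡0 p x@(ℚ.mkℚ (+ zero) _ _) _ = ℚP.↥p≡0⇒p≡0 x refl
  vp≡⊤⁺⇒≡0 p (ℚ.mkℚ (+ suc _)    _ _) ()
  vp≡⊤⁺⇒≡0 p (ℚ.mkℚ ℤ.-[1+ _ ] _ _) ()

  vpFrac-<⁺⇒nonZero : ∀ {p a b w} → vpFrac p a b <⁺ w → NonZero a
  vpFrac-<⁺⇒nonZero {a = suc _} _ = _

  vpFrac-nonZero : ∀ p a b .{{_ : NonZero a}} → vpFrac p a b ≡ [ + vpℕ p a - + vpℕ p b ]
  vpFrac-nonZero p (suc _) b = refl

  module _ {p : ℕ} (p-prime : Prime p) where

    private instance
      p-nonTrivial : NonTrivial p
      p-nonTrivial = prime⇒nonTrivial p-prime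

    vpFrac-cong : ∀ {a b c d} .{{_ : NonZero b}} .{{_ : NonZero d}} →
                  a ℕ.* d ≡ c ℕ.* b → vpFrac p a b ≡ vpFrac p c d
    vpFrac-cong {zero}      {b} {zero}      {d} _     = refl
    vpFrac-cong {zero}      {b} {suc c}     {d} ad≡cb =
      contradiction (sym ad≡cb) (ℕ.≢-nonZero⁻¹ _ {{ℕP.m*n≢0 (suc c) b}})
    vpFrac-cong {suc a}     {b} {zero}      {d} ad≡cb =
      contradiction ad≡cb (ℕ.≢-nonZero⁻¹ _ {{ℕP.m*n≢0 (suc a) d}})
    vpFrac-cong {a@(suc _)} {b} {c@(suc _)} {d} ad≡cb =
      cong [_] (pos-diff-≡ (vpℕ p a) (vpℕ p b) (vpℕ p c) (vpℕ p d) (begin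
        vpℕ p a ℕ.+ vpℕ p d  ≡⟨ vpℕ-* p-prime a d ⟨
        vpℕ p (a ℕ.* d)      ≡⟨ cong (vpℕ p) ad≡cb ⟩
        vpℕ p (c ℕ.* b)      ≡⟨ vpℕ-* p-prime c b ⟩
        vpℕ p c ℕ.+ vpℕ p b  ∎))
      where open ≡-Reasoning

    vpᵘ-cong : ∀ {x y} → x ℚᵘ.≃ y → vpᵘ p x ≡ vpᵘ p y
    vpᵘ-cong {mkℚᵘ a b-1} {mkℚᵘ c d-1} (*≡* ad≡cb) =
      vpFrac-cong (begin
        ℤ.∣ a ∣ ℕ.* suc d-1  ≡⟨ ℤP.abs-* a (+ suc d-1) ⟨
        ℤ.∣ a * + suc d-1 ∣  ≡⟨ cong ℤ.∣_∣ ad≡cb ⟩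
        ℤ.∣ c * + suc b-1 ∣  ≡⟨ ℤP.abs-* c (+ suc b-1) ⟩
        ℤ.∣ c ∣ ℕ.* suc b-1  ∎)
      where open ≡-Reasoning

    vpFrac-* : ∀ a b c d .{{_ : NonZero b}} .{{_ : NonZero d}} →
               vpFrac p (a ℕ.* c) (b ℕ.* d) ≡ zipWith _+_ (vpFrac p a b) (vpFrac p c d)
    vpFrac-* zero      b zero      d = refl
    vpFrac-* zero      b (suc _)   d = refl
    vpFrac-* (suc a)   b zero      d rewrite ℕP.*-zeroʳ a = refl
    vpFrac-* a@(suc _) b c@(suc _) d = cong [_] (begin
      + vpℕ p (a ℕ.* c) - + vpℕ p (b ℕ.* d)
        ≡⟨ cong₂ (λ m n → + m - + n) (vpℕ-* p-prime a c) (vpℕ-* p-prime b d) ⟩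
      + (vpℕ p a ℕ.+ vpℕ p c) - + (vpℕ p b ℕ.+ vpℕ p d)
        ≡⟨ pos-diff-+ (vpℕ p a) (vpℕ p b) (vpℕ p c) (vpℕ p d) ⟩
      (+ vpℕ p a - + vpℕ p b) + (+ vpℕ p c - + vpℕ p d)
        ∎)
      where open ≡-Reasoning

    vpᵘ-* : ∀ x y → vpᵘ p (x ℚᵘ.* y) ≡ zipWith _+_ (vpᵘ p x) (vpᵘ p y)
    vpᵘ-* (mkℚᵘ a b-1) (mkℚᵘ c d-1) rewrite ℤP.abs-* a c =
      vpFrac-* ℤ.∣ a ∣ (suc b-1) ℤ.∣ c ∣ (suc d-1)

    vpFrac-<⁺⇒∣ : ∀ a b c d .{{_ : NonZero b}} .{{_ : NonZero d}} → vpFrac p a b <⁺ vpFrac p c d →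
                  p ℕ.^ suc (vpℕ p (a ℕ.* d)) ∣ c ℕ.* b
    vpFrac-<⁺⇒∣ zero      b c         d ()
    vpFrac-<⁺⇒∣ (suc _)   b zero      d _      = _ ∣0
    vpFrac-<⁺⇒∣ a@(suc _) b c@(suc _) d [ lt ] =
      ∣-trans (^-monoʳ-∣ p v[ad]<v[cb]) (p^vpℕ∣ (c ℕ.* b))
      where
      open ℕP.≤-Reasoning
      v[ad]<v[cb] : vpℕ p (a ℕ.* d) ℕ.< vpℕ p (c ℕ.* b)
      v[ad]<v[cb] = begin-strict
        vpℕ p (a ℕ.* d)      ≡⟨ vpℕ-* p-prime a d ⟩
        vpℕ p a ℕ.+ vpℕ p d  <⟨ pos-diff-< (vpℕ p a) (vpℕ p b) (vpℕ p c) (vpℕ p d) lt ⟩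
        vpℕ p c ℕ.+ vpℕ p b  ≡⟨ vpℕ-* p-prime c b ⟨
        vpℕ p (c ℕ.* b)      ∎

    vpFrac-+ : ∀ a b c d .{{_ : NonZero b}} .{{_ : NonZero d}} →
               vpFrac p ℤ.∣ a ∣ b <⁺ vpFrac p ℤ.∣ c ∣ d →
               vpFrac p ℤ.∣ a * + d + c * + b ∣ (b ℕ.* d) ≡ vpFrac p ℤ.∣ a ∣ b
    vpFrac-+ a b c d v[a/b]<v[c/d] = begin
      vpFrac p ℤ.∣ a * + d + c * + b ∣ (b ℕ.* d)
        ≡⟨ vpFrac-nonZero p _ (b ℕ.* d) {{ad+cb≢0}} ⟩
      [ + vpℕ p ℤ.∣ a * + d + c * + b ∣ - + vpℕ p (b ℕ.* d) ]
        ≡⟨ cong₂ (λ m n → [ + m - + n ]) (trans v[ad+cb]≡v[ad] v[ad]) (vpℕ-* p-prime b d) ⟩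
      [ + (va ℕ.+ vd) - + (vb ℕ.+ vd) ]
        ≡⟨ cong [_] (pos-diff-≡ (va ℕ.+ vd) (vb ℕ.+ vd) va vb (+-comm-right va vd vb)) ⟩
      [ + va - + vb ]
        ≡⟨ vpFrac-nonZero p ℤ.∣ a ∣ b ⟨
      vpFrac p ℤ.∣ a ∣ b
        ∎
      where
      open ≡-Reasoning
      instance
        a≢0 : ℤ.NonZero a
        a≢0 = vpFrac-<⁺⇒nonZero v[a/b]<v[c/d]
        ad≢0 : ℤ.NonZero (a * + d)
        ad≢0 = ℤP.i*j≢0 a (+ d)
      va vb vd : ℕ
      va = vpℕ p ℤ.∣ a ∣
      vb = vpℕ p b
      vd = vpℕ p d
      +-comm-right : ∀ x y z → x ℕ.+ y ℕ.+ z ≡ x ℕ.+ (z ℕ.+ y)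
      +-comm-right x y z = trans (ℕP.+-assoc x y z) (cong (x ℕ.+_) (ℕP.+-comm y z))
      v[ad] : vpℕ p ℤ.∣ a * + d ∣ ≡ va ℕ.+ vd
      v[ad] = trans (cong (vpℕ p) (ℤP.abs-* a (+ d))) (vpℕ-* p-prime ℤ.∣ a ∣ d)
      p^1+v[ad]∣cb : p ℕ.^ suc (vpℕ p ℤ.∣ a * + d ∣) ∣ ℤ.∣ c * + b ∣
      p^1+v[ad]∣cb rewrite ℤP.abs-* a (+ d) | ℤP.abs-* c (+ b) =
        vpFrac-<⁺⇒∣ ℤ.∣ a ∣ b ℤ.∣ c ∣ d v[a/b]<v[c/d]
      ad+cb≢0 : ℤ.NonZero (a * + d + c * + b)
      ad+cb≢0 = proj₁ (vpℕ-∣+∣ (a * + d) (c * + b) p^1+v[ad]∣cb)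
      v[ad+cb]≡v[ad] : vpℕ p ℤ.∣ a * + d + c * + b ∣ ≡ vpℕ p ℤ.∣ a * + d ∣
      v[ad+cb]≡v[ad] = proj₂ (vpℕ-∣+∣ (a * + d) (c * + b) p^1+v[ad]∣cb)

    vpᵘ-+ : ∀ x y → vpᵘ p x <⁺ vpᵘ p y → vpᵘ p (x ℚᵘ.+ y) ≡ vpᵘ p x
    vpᵘ-+ (mkℚᵘ a b-1) (mkℚᵘ c d-1) = vpFrac-+ a (suc b-1) c (suc d-1)

    vp-* : ∀ x y → vp p (x ℚ.* y) ≡ zipWith _+_ (vp p x) (vp p y)
    vp-* x y = begin
      vp p (x ℚ.* y)                                 ≡⟨ vp≡vpᵘ p (x ℚ.* y) ⟩
      vpᵘ p (toℚᵘ (x ℚ.* y))                         ≡⟨ vpᵘ-cong (ℚP.toℚᵘ-homo-* x y) ⟩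
      vpᵘ p (toℚᵘ x ℚᵘ.* toℚᵘ y)                     ≡⟨ vpᵘ-* (toℚᵘ x) (toℚᵘ y) ⟩
      zipWith _+_ (vpᵘ p (toℚᵘ x)) (vpᵘ p (toℚᵘ y))  ≡⟨ cong₂ (zipWith _+_) (vp≡vpᵘ p x) (vp≡vpᵘ p y) ⟨
      zipWith _+_ (vp p x) (vp p y)                  ∎
      where open ≡-Reasoning

    vp-+ : ∀ x y → vp p x <⁺ vp p y → vp p (x ℚ.+ y) ≡ vp p x
    vp-+ x y v<v = begin
      vp p (x ℚ.+ y)              ≡⟨ vp≡vpᵘ p (x ℚ.+ y) ⟩
      vpᵘ p (toℚᵘ (x ℚ.+ y))      ≡⟨ vpᵘ-cong (ℚP.toℚᵘ-homo-+ x y) ⟩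
      vpᵘ p (toℚᵘ x ℚᵘ.+ toℚᵘ y)  ≡⟨ vpᵘ-+ (toℚᵘ x) (toℚᵘ y) (subst₂ _<⁺_ (vp≡vpᵘ p x) (vp≡vpᵘ p y) v<v) ⟩
      vpᵘ p (toℚᵘ x)              ≡⟨ vp≡vpᵘ p x ⟨
      vp p x                      ∎
      where open ≡-Reasoning

    vp-/ : ∀ i d .{{_ : NonZero d}} → vp p (i ℚ./ d) ≡ vpFrac p ℤ.∣ i ∣ d
    vp-/ i (suc d) = trans (vp≡vpᵘ p (i ℚ./ suc d)) (vpᵘ-cong (ℚP.toℚᵘ-fromℚᵘ (mkℚᵘ i d)))

    [n]<vpFrac : ∀ {n a d} .{{_ : NonZero a}} → p ℕ.^ suc n ∣ a → ¬ p ∣ d → [ + n ] <⁺ vpFrac p a d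
    [n]<vpFrac {n} {a@(suc _)} {d} p^1+n∣a p∤d rewrite p∤⇒vpℕ≡0 p∤d | ℤP.+-identityʳ (+ vpℕ p a) =
      [ ℤ.+<+ (p^k∣⇒k≤vpℕ a p^1+n∣a) ]

open FractionValuation

module Limits where

  open import Data.Nat using (_≤_)
  import Data.Nat.Properties as ℕP
  open import Data.Integer using (_+_; _-_; _<_)
  import Data.Integer.Properties as ℤP
  open import Data.Integer.Tactic.RingSolver using (solve-∀)
  open import Data.Rational using (0ℚ)
  import Data.Rational.Properties as ℚP
  open import Data.Maybe using (zipWith)

  Eventually : (ℕ → Set) → Set
  Eventually P = ∃[ N ] (∀ {n} → N ≤ n → P n)

  eventually-witness : ∀ {P : ℕ → Set} → Eventually P → ∃[ n ] P n
  eventually-witness (N , P) = N , P ℕP.≤-refl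

  eventually-always : ∀ {P : ℕ → Set} → (∀ n → P n) → Eventually P
  eventually-always P = 0 , λ {n} _ → P n

  eventually-map : ∀ {P Q : ℕ → Set} → (∀ {n} → P n → Q n) → Eventually P → Eventually Q
  eventually-map f (N , P) = N , f ∘ P

  eventually-zipWith : ∀ {P Q R : ℕ → Set} → (∀ {n} → P n → Q n → R n) →
                       Eventually P → Eventually Q → Eventually R
  eventually-zipWith _∙_ (M , P) (N , Q) =
    M ℕ.⊔ N , λ M⊔N≤n → P (ℕP.m⊔n≤o⇒m≤o M N M⊔N≤n) ∙ Q (ℕP.m⊔n≤o⇒n≤o M N M⊔N≤n)

  eventually-All : ∀ {A : Set} {P : A → ℕ → Set} {xs} →
                   All (λ x → Eventually (P x)) xs → Eventually (λ n → All (λ x → P x n) xs)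
  eventually-All []       = eventually-always λ _ → []
  eventually-All (E ∷ Es) = eventually-zipWith _∷_ E (eventually-All Es)

  -- w n → 0 in ℝ, phrased without division.
  TendsToZero : (ℕ → ℚ) → Set
  TendsToZero w = ∀ D g → 0ℚ ℚ.< g → Eventually (λ n → w n ℚ.* D ℚ.< g)

  TendsToTop : (ℕ → ℤ ⁺) → Set
  TendsToTop f = ∀ K → Eventually (λ n → [ K ] <⁺ f n)

  ≤-<⁺-trans : ∀ {K L w} → K ℤ.≤ L → [ L ] <⁺ w → [ K ] <⁺ w
  ≤-<⁺-trans K≤L [ L<v ]  = [ ℤP.≤-<-trans K≤L L<v ]
  ≤-<⁺-trans K≤L [ _ ]<⊤⁺ = [ _ ]<⊤⁺

  [n]<⁺⇒tendsToTop : ∀ {f} → (∀ n → [ + n ] <⁺ f n) → TendsToTop f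
  [n]<⁺⇒tendsToTop {f} n<f K =
    ℤ.∣ K ∣ , λ {n} ∣K∣≤n → ≤-<⁺-trans (ℤP.≤-trans (i≤+∣i∣ K) (ℤ.+≤+ ∣K∣≤n)) (n<f n)

  <⁺-zipWith-+ : ∀ K d u → [ K - d ] <⁺ u → [ K ] <⁺ zipWith _+_ u [ d ]
  <⁺-zipWith-+ K d ⊤⁺    _      = [ K ]<⊤⁺
  <⁺-zipWith-+ K d [ m ] [ lt ] = [ subst (_< m + d) (cancel K d) (ℤP.+-monoˡ-< d lt) ]
    where
    cancel : ∀ x y → x - y + y ≡ x
    cancel = solve-∀

  tendsToTop-zipWith-+ : ∀ {f} → TendsToTop f → ∀ w → TendsToTop (λ n → zipWith _+_ (f n) w)
  tendsToTop-zipWith-+ {f} f→⊤ ⊤⁺ K = eventually-always λ n → <⊤⁺ (f n)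
    where
    <⊤⁺ : ∀ u → [ K ] <⁺ zipWith _+_ u ⊤⁺
    <⊤⁺ ⊤⁺    = [ K ]<⊤⁺
    <⊤⁺ [ _ ] = [ K ]<⊤⁺
  tendsToTop-zipWith-+ {f} f→⊤ [ d ] K =
    eventually-map (λ {n} → <⁺-zipWith-+ K d (f n)) (f→⊤ (K - d))

  ⟦⟧V-⊤⁺⇒above : ∀ r {c w} → [ c ] <⁺ w → ⟦ r ⟧V c ⊤⁺ → ⟦ r ⟧V c w
  ⟦⟧V-⊤⁺⇒above ge  [ c<v ]  _ = ℤP.<⇒≤ c<v
  ⟦⟧V-⊤⁺⇒above neq [ c<v ]  _ = ℤP.<⇒≢ c<v ∘ sym
  ⟦⟧V-⊤⁺⇒above r   [ _ ]<⊤⁺ h = h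

  module _ {p : ℕ} (p-prime : Prime p) where

    tendsToTop-vp-* : ∀ {μ : ℕ → ℚ} → TendsToTop (λ n → vp p (μ n)) →
                      ∀ Δ → TendsToTop (λ n → vp p (μ n ℚ.* Δ))
    tendsToTop-vp-* {μ} μ→⊤ Δ K =
      eventually-map (λ {n} → subst ([ K ] <⁺_) (sym (vp-* p-prime (μ n) Δ)))
                     (tendsToTop-zipWith-+ {λ n → vp p (μ n)} μ→⊤ (vp p Δ) K)

    ⟦⟧V-eventually : ∀ {y : ℕ → ℚ} r c x → TendsToTop (λ n → vp p (y n)) → ⟦ r ⟧V c (vp p x) →
                     Eventually (λ n → ⟦ r ⟧V c (vp p (x ℚ.+ y n)))
    ⟦⟧V-eventually {y} r c x y→⊤ holds with vp p x in v[x]≡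
    ... | [ a ] = eventually-map stays (y→⊤ a)
      where
      stays : ∀ {n} → [ a ] <⁺ vp p (y n) → ⟦ r ⟧V c (vp p (x ℚ.+ y n))
      stays {n} a<v[yn] rewrite vp-+ p-prime x (y n) (subst (_<⁺ vp p (y n)) (sym v[x]≡) a<v[yn]) | v[x]≡ =
        holds
    ... | ⊤⁺ = eventually-map stays (y→⊤ c)
      where
      stays : ∀ {n} → [ c ] <⁺ vp p (y n) → ⟦ r ⟧V c (vp p (x ℚ.+ y n))
      stays {n} c<v[yn] rewrite vp≡⊤⁺⇒≡0 p x v[x]≡ | ℚP.+-identityˡ (y n) =
        ⟦⟧V-⊤⁺⇒above r c<v[yn] holds

open Limits

module WeakApproximation where

  open import Data.Nat using (_+_; _*_; _^_; _≤_; _<_)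
  import Data.Nat.Properties as ℕP
  open import Data.Nat.Divisibility
  open import Data.Nat.ListAction using (product)
  open import Data.Nat.ListAction.Properties using (∈⇒∣product)
  open import Data.Nat.Primality using (euclidsLemma; prime⇒nonZero; productOfPrimes≢0)
  open import Data.Nat.Primality.Factorisation using (factorisationHasAllPrimeFactors)
  import Data.Integer.Properties as ℤP
  open import Data.Integer.Tactic.RingSolver using (solve-∀)
  open import Data.Rational using (0ℚ; _/_; toℚᵘ)
  import Data.Rational.Properties as ℚP
  open import Data.Rational.Unnormalised as ℚᵘ using (mkℚᵘ; *≡*; *<*)
  import Data.Rational.Unnormalised.Properties as ℚᵘP
  open import Data.List.Membership.Propositional using (_∈_)

  toℚᵘ-/ : ∀ i d .{{_ : NonZero d}} → toℚᵘ (i / d) ℚᵘ.≃ i ℚᵘ./ d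
  toℚᵘ-/ i (suc d) = ℚP.toℚᵘ-fromℚᵘ (mkℚᵘ i d)

  1-[a/c]≡b/c : ∀ a b c .{{_ : NonZero c}} → a + b ≡ c → 1ℚ ℚ.- + a / c ≡ + b / c
  1-[a/c]≡b/c a b c@(suc c-1) a+b≡c = ℚP.toℚᵘ-injective (begin
    toℚᵘ (1ℚ ℚ.- + a / c)              ≈⟨ ℚP.toℚᵘ-homo-+ 1ℚ (ℚ.- (+ a / c)) ⟩
    toℚᵘ 1ℚ ℚᵘ.+ toℚᵘ (ℚ.- (+ a / c))  ≈⟨ ℚᵘP.+-congʳ (toℚᵘ 1ℚ) toℚᵘ[-a/c]≃ ⟩
    ℚᵘ.1ℚᵘ ℚᵘ.- mkℚᵘ (+ a) c-1         ≈⟨ *≡* (cross (+ a) (+ b) (+ c) c≡a+b) ⟩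
    mkℚᵘ (+ b) c-1                     ≈⟨ toℚᵘ-/ (+ b) c ⟨
    toℚᵘ (+ b / c)                     ∎)
    where
    open ℚᵘP.≃-Reasoning
    c≡a+b : + c ≡ + a ℤ.+ + b
    c≡a+b = trans (cong +_ (sym a+b≡c)) (ℤP.pos-+ a b)
    toℚᵘ[-a/c]≃ : toℚᵘ (ℚ.- (+ a / c)) ℚᵘ.≃ ℚᵘ.- mkℚᵘ (+ a) c-1
    toℚᵘ[-a/c]≃ = ℚᵘP.≃-trans (ℚP.toℚᵘ-homo‿- (+ a / c)) (ℚᵘP.-‿cong (toℚᵘ-/ (+ a) c))
    cross : ∀ x y z → z ≡ x ℤ.+ y → (ℤ.+ 1 ℤ.* z ℤ.+ ℤ.- x ℤ.* ℤ.+ 1) ℤ.* z ≡ y ℤ.* (ℤ.+ 1 ℤ.* z)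
    cross x y z refl = ring x y
      where
      ring : ∀ x y → (ℤ.+ 1 ℤ.* (x ℤ.+ y) ℤ.+ ℤ.- x ℤ.* ℤ.+ 1) ℤ.* (x ℤ.+ y) ≡
                     y ℤ.* (ℤ.+ 1 ℤ.* (x ℤ.+ y))
      ring = solve-∀

  [u/v]*D<g : ∀ {u v n} .{{_ : NonZero v}} D g → 0ℚ ℚ.< g → n * u < v →
              ℤ.∣ ℚ.↥ D ∣ * ℚ.↧ₙ g ≤ n → + u / v ℚ.* D ℚ.< g
  [u/v]*D<g _ (ℚ.mkℚ (+ zero)     _ _) (ℚ.*<* (ℤ.+<+ ())) _ _
  [u/v]*D<g _ (ℚ.mkℚ ℤ.-[1+ _ ] _ _) (ℚ.*<* ())         _ _
  [u/v]*D<g {u} {v@(suc _)} {n} D@record{} g@(ℚ.mkℚ (+ suc k) g₂-1 _) _ nu<v ∣d∣g₂≤n =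
    ℚP.toℚᵘ-cancel-< (ℚᵘP.<-respˡ-≃ (ℚᵘP.≃-sym toℚᵘ[uD/v]≃) (*<* ud<g))
    where
    d : ℤ
    d = ℚ.↥ D
    e g₂ : ℕ
    e  = ℚ.↧ₙ D
    g₂ = suc g₂-1
    toℚᵘ[uD/v]≃ : toℚᵘ (+ u / v ℚ.* D) ℚᵘ.≃ (+ u ℚᵘ./ v) ℚᵘ.* toℚᵘ D
    toℚᵘ[uD/v]≃ = ℚᵘP.≃-trans (ℚP.toℚᵘ-homo-* (+ u / v) D) (ℚᵘP.*-congʳ (toℚᵘ-/ (+ u) v))
    bound : u * ℤ.∣ d ∣ * g₂ < suc k * (v * e)
    bound = begin-strict
      u * ℤ.∣ d ∣ * g₂    ≡⟨ ℕP.*-assoc u ℤ.∣ d ∣ g₂ ⟩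
      u * (ℤ.∣ d ∣ * g₂)  ≤⟨ ℕP.*-monoʳ-≤ u ∣d∣g₂≤n ⟩
      u * n               ≡⟨ ℕP.*-comm u n ⟩
      n * u               <⟨ nu<v ⟩
      v                   ≤⟨ ℕP.m≤m*n v e ⟩
      v * e               ≤⟨ ℕP.m≤n*m (v * e) (suc k) ⟩
      suc k * (v * e)     ∎
      where open ℕP.≤-Reasoning
    ud<g : (+ u ℤ.* d) ℤ.* + g₂ ℤ.< + suc k ℤ.* + (v * e)
    ud<g = begin-strict
      (+ u ℤ.* d) ℤ.* + g₂          ≤⟨ i≤+∣i∣ _ ⟩
      + ℤ.∣ (+ u ℤ.* d) ℤ.* + g₂ ∣  ≡⟨ cong +_ (ℤP.abs-* (+ u ℤ.* d) (+ g₂)) ⟩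
      + (ℤ.∣ + u ℤ.* d ∣ * g₂)      ≡⟨ cong (λ x → + (x * g₂)) (ℤP.abs-* (+ u) d) ⟩
      + (u * ℤ.∣ d ∣ * g₂)          <⟨ ℤ.+<+ bound ⟩
      + (suc k * (v * e))           ≡⟨ ℤP.pos-* (suc k) (v * e) ⟩
      + suc k ℤ.* + (v * e)         ∎
      where open ℤP.≤-Reasoning

  record Weights (p : ℕ) (S : List ℕ) : Set where
    field
      weight        : ℕ → ℚ
      weight→0      : TendsToZero weight
      weight→0-at-S : All (λ q → TendsToTop (λ n → vp q (weight n))) S
      weight→1-at-p : TendsToTop (λ n → vp p (1ℚ ℚ.- weight n))

  module _ {p S} (p-prime : Prime p) (S-primes : All Prime S) (p∉S : p ∉ S) where

    private
      instance
        p≢0 : NonZero p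
        p≢0 = prime⇒nonZero p-prime
        P≢0 : NonZero (product S)
        P≢0 = productOfPrimes≢0 S-primes

      -- The weight U n / V n is q-adically small for q ∈ S, and 1 − U n / V n = W n / V n is
      -- p-adically small.
      U W V : ℕ → ℕ
      U n = product S ^ suc n
      W n = p ^ suc n * suc (suc n * U n)
      V n = U n + W n

      U≢0 : ∀ n → NonZero (U n)
      U≢0 n = ℕP.m^n≢0 (product S) (suc n)
      W≢0 : ∀ n → NonZero (W n)
      W≢0 n = ℕP.m*n≢0 (p ^ suc n) _ {{ℕP.m^n≢0 p (suc n)}}
      V≢0 : ∀ n → NonZero (V n)
      V≢0 n = ℕ.>-nonZero (ℕP.<-≤-trans (ℕ.>-nonZero⁻¹ (W n) {{W≢0 n}}) (ℕP.m≤n+m (W n) (U n)))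

      p^1+n∣W : ∀ n → p ^ suc n ∣ W n
      p^1+n∣W n = m∣m*n _

      p∤V : ∀ n → ¬ p ∣ V n
      p∤V n p∣V = p∉S (factorisationHasAllPrimeFactors p-prime p∣P S-primes)
        where
        p∣U : p ∣ U n
        p∣U = ∣m+n∣m⇒∣n (subst (p ∣_) (ℕP.+-comm (U n) (W n)) p∣V) (∣-trans (m∣m*n (p ^ n)) (p^1+n∣W n))
        p∣P : p ∣ product S
        p∣P = prime∣^⇒∣ p-prime (suc n) p∣U

      q∤V : ∀ {q} → q ∈ S → ∀ n → ¬ q ∣ V n
      q∤V {q} q∈S n q∣V =
        [ q∤p^1+n , q∤1+[1+n]U ]′ (euclidsLemma (p ^ suc n) _ q-prime (∣m+n∣m⇒∣n q∣V q∣U))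
        where
        q-prime : Prime q
        q-prime = All.lookup S-primes q∈S
        q∣U : q ∣ U n
        q∣U = ∣-trans (∈⇒∣product q∈S) (m∣m*n _)
        q∤p^1+n : ¬ q ∣ p ^ suc n
        q∤p^1+n q∣p^1+n =
          p∉S (subst (_∈ S) (prime∣prime⇒≡ q-prime p-prime (prime∣^⇒∣ q-prime (suc n) q∣p^1+n)) q∈S)
        q∤1+[1+n]U : ¬ q ∣ suc (suc n * U n)
        q∤1+[1+n]U q∣1+[1+n]U =
          prime∤1 q-prime (∣m+n∣m⇒∣n (subst (q ∣_) (ℕP.+-comm 1 _) q∣1+[1+n]U) (∣n⇒∣m*n (suc n) q∣U))

      nU<V : ∀ n → n * U n < V n
      nU<V n = begin-strict
        n * U n            ≤⟨ ℕP.m≤n+m (n * U n) (U n) ⟩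
        suc n * U n        <⟨ ℕP.n<1+n _ ⟩
        suc (suc n * U n)  ≤⟨ ℕP.m≤n*m _ (p ^ suc n) {{ℕP.m^n≢0 p (suc n)}} ⟩
        W n                ≤⟨ ℕP.m≤n+m (W n) (U n) ⟩
        V n                ∎
        where open ℕP.≤-Reasoning

      w : ℕ → ℚ
      w n = (+ U n / V n) {{V≢0 n}}

      w→0-at : ∀ {q} → q ∈ S → TendsToTop (λ n → vp q (w n))
      w→0-at {q} q∈S = [n]<⁺⇒tendsToTop λ n →
        subst ([ + n ] <⁺_) (sym (vp-/ q-prime (+ U n) (V n) {{V≢0 n}}))
              ([n]<vpFrac q-prime {{U≢0 n}} (^-monoˡ-∣ (suc n) (∈⇒∣product q∈S)) (q∤V q∈S n))
        where
        q-prime : Prime q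
        q-prime = All.lookup S-primes q∈S

      1-w→0-at-p : TendsToTop (λ n → vp p (1ℚ ℚ.- w n))
      1-w→0-at-p = [n]<⁺⇒tendsToTop λ n →
        subst ([ + n ] <⁺_) (sym (trans (cong (vp p) (1-[a/c]≡b/c (U n) (W n) (V n) {{V≢0 n}} refl))
                                        (vp-/ p-prime (+ W n) (V n) {{V≢0 n}})))
              ([n]<vpFrac p-prime {{W≢0 n}} (p^1+n∣W n) (p∤V n))

    weights : Weights p S
    weights = record
      { weight        = w
      ; weight→0      = λ D g 0<g →
          ℤ.∣ ℚ.↥ D ∣ * ℚ.↧ₙ g , λ {n} → [u/v]*D<g {{V≢0 n}} D g 0<g (nU<V n)
      ; weight→0-at-S = All.tabulate w→0-at
      ; weight→1-at-p = 1-w→0-at-p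
      }

open WeakApproximation

module Interpolation where

  open import Data.Rational using (0ℚ; _+_; _*_; _-_; _<_)
  import Data.Rational.Properties as ℚP
  open import Data.Rational.Solver using (module +-*-Solver)
  open +-*-Solver

  _⊨_ : Assignment → Conj → Set
  ρ ⊨ φ = All (HoldsAtom ρ) φ

  interpolate : Assignment → Assignment → ℚ → Assignment
  interpolate ρ σ l i = ρ i + l * (σ i - ρ i)

  eval-interpolate : ∀ ρ σ l t → eval (interpolate ρ σ l) t ≡ eval ρ t + l * (eval σ t - eval ρ t)
  eval-interpolate ρ σ l (var i) = refl
  eval-interpolate ρ σ l one     = solve 1 (λ l → con 1ℚ := con 1ℚ :+ l :* (con 1ℚ :- con 1ℚ)) refl l
  eval-interpolate ρ σ l (t ⊕ s) rewrite eval-interpolate ρ σ l t | eval-interpolate ρ σ l s =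
    solve 5 (λ l a a′ b b′ →
      (a :+ l :* (a′ :- a)) :+ (b :+ l :* (b′ :- b)) := (a :+ b) :+ l :* ((a′ :+ b′) :- (a :+ b)))
      refl l (eval ρ t) (eval σ t) (eval ρ s) (eval σ s)

  interpolate-swap : ∀ l a b → a + l * (b - a) ≡ b + (1ℚ - l) * (a - b)
  interpolate-swap = solve 3 (λ l a b → a :+ l :* (b :- a) := b :+ (con 1ℚ :- l) :* (a :- b)) refl

  eqPart-interpolate : ∀ {ρ σ} l φ → ρ ⊨ eqPart φ → σ ⊨ eqPart φ → interpolate ρ σ l ⊨ eqPart φ
  eqPart-interpolate l []                   _                 _                 = []
  eqPart-interpolate {ρ} {σ} l ((t ≐ s) ∷ φ) (ρt≡ρs ∷ ρ⊨φ) (σt≡σs ∷ σ⊨φ) =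
    t≡s ∷ eqPart-interpolate l φ ρ⊨φ σ⊨φ
    where
    t≡s : eval (interpolate ρ σ l) t ≡ eval (interpolate ρ σ l) s
    t≡s = begin
      eval (interpolate ρ σ l) t            ≡⟨ eval-interpolate ρ σ l t ⟩
      eval ρ t + l * (eval σ t - eval ρ t)  ≡⟨ cong₂ (λ a b → a + l * (b - a)) ρt≡ρs σt≡σs ⟩
      eval ρ s + l * (eval σ s - eval ρ s)  ≡⟨ eval-interpolate ρ σ l s ⟨
      eval (interpolate ρ σ l) s            ∎
      where open ≡-Reasoning
  eqPart-interpolate l ((_ ≺ _) ∷ φ)        ρ⊨φ σ⊨φ = eqPart-interpolate l φ ρ⊨φ σ⊨φ
  eqPart-interpolate l (vrel _ _ _ _ _ ∷ φ) ρ⊨φ σ⊨φ = eqPart-interpolate l φ ρ⊨φ σ⊨φ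

  module _ {w : ℕ → ℚ} (w→0 : TendsToZero w) (ρ σ : Assignment) where

    ≺-eventually : ∀ t s → eval ρ t < eval ρ s →
                   Eventually (λ n → eval (interpolate ρ σ (w n)) t < eval (interpolate ρ σ (w n)) s)
    ≺-eventually t s a<b = eventually-map interpolation-< (w→0 D (b - a) 0<b-a)
      where
      a b a′ b′ D : ℚ
      a  = eval ρ t
      b  = eval ρ s
      a′ = eval σ t
      b′ = eval σ s
      D  = (a′ - a) - (b′ - b)
      0<b-a : 0ℚ < b - a
      0<b-a = subst (_< b - a) (ℚP.+-inverseʳ a) (ℚP.+-monoˡ-< (ℚ.- a) a<b)
      interpolation-< : ∀ {n} → w n * D < b - a →
                        eval (interpolate ρ σ (w n)) t < eval (interpolate ρ σ (w n)) s
      interpolation-< {n} lD<b-a = begin-strict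
        eval (interpolate ρ σ l) t    ≡⟨ eval-interpolate ρ σ l t ⟩
        a + l * (a′ - a)              ≡⟨ regroup l a a′ b b′ ⟩
        (a + l * D) + l * (b′ - b)    <⟨ ℚP.+-monoˡ-< (l * (b′ - b)) (ℚP.+-monoʳ-< a lD<b-a) ⟩
        (a + (b - a)) + l * (b′ - b)  ≡⟨ cong (_+ l * (b′ - b)) (cancel a b) ⟩
        b + l * (b′ - b)              ≡⟨ eval-interpolate ρ σ l s ⟨
        eval (interpolate ρ σ l) s    ∎
        where
        open ℚP.≤-Reasoning
        l : ℚ
        l = w n
        regroup : ∀ l a a′ b b′ → a + l * (a′ - a) ≡ (a + l * ((a′ - a) - (b′ - b))) + l * (b′ - b)
        regroup = solve 5 (λ l a a′ b b′ →
          a :+ l :* (a′ :- a) := (a :+ l :* ((a′ :- a) :- (b′ :- b))) :+ l :* (b′ :- b)) refl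
        cancel : ∀ a b → a + (b - a) ≡ b
        cancel = solve 2 (λ a b → a :+ (b :- a) := b) refl

    ltPart-eventually : ∀ φ → ρ ⊨ ltPart φ → Eventually (λ n → interpolate ρ σ (w n) ⊨ ltPart φ)
    ltPart-eventually []                   _           = eventually-always λ _ → []
    ltPart-eventually ((_ ≐ _) ∷ φ)        ρ⊨φ         = ltPart-eventually φ ρ⊨φ
    ltPart-eventually ((t ≺ s) ∷ φ)        (t<s ∷ ρ⊨φ) =
      eventually-zipWith _∷_ (≺-eventually t s t<s) (ltPart-eventually φ ρ⊨φ)
    ltPart-eventually (vrel _ _ _ _ _ ∷ φ) ρ⊨φ         = ltPart-eventually φ ρ⊨φ

  module _ {q : ℕ} (q-prime : Prime q) {μ : ℕ → ℚ} (μ→⊤ : TendsToTop (λ n → vp q (μ n)))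
           {β : Assignment} {ρ′ : ℕ → Assignment} {Δ : Term → ℚ}
           (ρ′≡ : ∀ n t → eval (ρ′ n) t ≡ eval β t + μ n * Δ t) where

    pPart-eventually : ∀ φ → β ⊨ pPart q φ → Eventually (λ n → ρ′ n ⊨ pPart q φ)
    pPart-eventually []                    _   = eventually-always λ _ → []
    pPart-eventually ((_ ≐ _) ∷ φ)         β⊨φ = pPart-eventually φ β⊨φ
    pPart-eventually ((_ ≺ _) ∷ φ)         β⊨φ = pPart-eventually φ β⊨φ
    pPart-eventually (vrel q′ _ r c t ∷ φ) β⊨φ with q ℕ.≟ q′
    pPart-eventually (vrel q′ _ r c t ∷ φ) β⊨φ         | no _     = pPart-eventually φ β⊨φ
    pPart-eventually (vrel .q _ r c t ∷ φ) (β⊨a ∷ β⊨φ) | yes refl =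
      eventually-zipWith _∷_ atom (pPart-eventually φ β⊨φ)
      where
      atom : Eventually (λ n → ⟦ r ⟧V c (vp q (eval (ρ′ n) t)))
      atom = eventually-map (λ {n} → subst (λ z → ⟦ r ⟧V c (vp q z)) (sym (ρ′≡ n t)))
        (⟦⟧V-eventually q-prime r c (eval β t) (tendsToTop-vp-* q-prime μ→⊤ (Δ t)) β⊨a)

open Interpolation

eqPart-⊆ : ∀ φ → eqPart φ ⊆ φ
eqPart-⊆ []                       = []
eqPart-⊆ ((_ ≐ _) ∷ φ)            = refl ∷ eqPart-⊆ φ
eqPart-⊆ (a@(_ ≺ _) ∷ φ)          = a ∷ʳ eqPart-⊆ φ
eqPart-⊆ (a@(vrel _ _ _ _ _) ∷ φ) = a ∷ʳ eqPart-⊆ φ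

ltPart-⊆ : ∀ φ → ltPart φ ⊆ φ
ltPart-⊆ []                       = []
ltPart-⊆ (a@(_ ≐ _) ∷ φ)          = a ∷ʳ ltPart-⊆ φ
ltPart-⊆ ((_ ≺ _) ∷ φ)            = refl ∷ ltPart-⊆ φ
ltPart-⊆ (a@(vrel _ _ _ _ _) ∷ φ) = a ∷ʳ ltPart-⊆ φ

pPart-⊆ : ∀ p φ → pPart p φ ⊆ φ
pPart-⊆ p []                       = []
pPart-⊆ p (a@(_ ≐ _) ∷ φ)          = a ∷ʳ pPart-⊆ p φ
pPart-⊆ p (a@(_ ≺ _) ∷ φ)          = a ∷ʳ pPart-⊆ p φ
pPart-⊆ p (a@(vrel q _ _ _ _) ∷ φ) with p ℕ.≟ q
... | yes _ = refl ∷ pPart-⊆ p φ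
... | no  _ = a ∷ʳ pPart-⊆ p φ

pPart-head : ∀ {P : Atom → Set} q pr r c t φ →
             All P (pPart q (vrel q pr r c t ∷ φ)) → P (vrel q pr r c t)
pPart-head q pr r c t φ Ps with q ℕ.≟ q
... | yes _  = All.head Ps
... | no q≢q = contradiction refl q≢q

pPart-tail : ∀ {P : Atom → Set} q a φ → All P (pPart q (a ∷ φ)) → All P (pPart q φ)
pPart-tail q (_ ≐ _)           φ Ps = Ps
pPart-tail q (_ ≺ _)           φ Ps = Ps
pPart-tail q (vrel q′ _ _ _ _) φ Ps with q ℕ.≟ q′
... | yes _ = All.tail Ps
... | no  _ = Ps

primesOf : Conj → List ℕ
primesOf []                   = []
primesOf ((_ ≐ _) ∷ φ)        = primesOf φ
primesOf ((_ ≺ _) ∷ φ)        = primesOf φ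
primesOf (vrel q _ _ _ _ ∷ φ) = q ∷ primesOf φ

primesOf-prime : ∀ φ → All Prime (primesOf φ)
primesOf-prime []                         = []
primesOf-prime ((_ ≐ _) ∷ φ)              = primesOf-prime φ
primesOf-prime ((_ ≺ _) ∷ φ)              = primesOf-prime φ
primesOf-prime (vrel _ q-prime _ _ _ ∷ φ) = q-prime ∷ primesOf-prime φ

_⊨⟨_⟩_ : Assignment → List ℕ → Conj → Set
ρ ⊨⟨ S ⟩ φ = ρ ⊨ eqPart φ × ρ ⊨ ltPart φ × All (λ q → ρ ⊨ pPart q φ) S

⊨⟨primesOf⟩⇒⊨ : ∀ {ρ} φ → ρ ⊨⟨ primesOf φ ⟩ φ → ρ ⊨ φ
⊨⟨primesOf⟩⇒⊨ []                        _                           = []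
⊨⟨primesOf⟩⇒⊨ ((_ ≐ _) ∷ φ)             (t≡s ∷ ρ⊨eq , ρ⊨lt , ρ⊨ps) =
  t≡s ∷ ⊨⟨primesOf⟩⇒⊨ φ (ρ⊨eq , ρ⊨lt , ρ⊨ps)
⊨⟨primesOf⟩⇒⊨ ((_ ≺ _) ∷ φ)             (ρ⊨eq , t<s ∷ ρ⊨lt , ρ⊨ps) =
  t<s ∷ ⊨⟨primesOf⟩⇒⊨ φ (ρ⊨eq , ρ⊨lt , ρ⊨ps)
⊨⟨primesOf⟩⇒⊨ (a@(vrel q pr r c t) ∷ φ) (ρ⊨eq , ρ⊨lt , ρ⊨q ∷ ρ⊨ps) =
  pPart-head q pr r c t φ ρ⊨q ∷
  ⊨⟨primesOf⟩⇒⊨ φ (ρ⊨eq , ρ⊨lt , All.map (λ {q′} → pPart-tail q′ a φ) ρ⊨ps)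

add-prime : ∀ {p S ρ σ} φ → Prime p → All Prime S → p ∉ S →
            ρ ⊨⟨ S ⟩ φ → σ ⊨ eqPart φ → σ ⊨ pPart p φ → ∃[ ρ′ ] ρ′ ⊨⟨ p ∷ S ⟩ φ
add-prime {p} {S} {ρ} {σ} φ p-prime S-primes p∉S (ρ⊨eq , ρ⊨lt , ρ⊨S) σ⊨eq σ⊨p =
  let N , ρ′⊨lt , ρ′⊨p , ρ′⊨S =
        eventually-witness (eventually-zipWith _,_ lt (eventually-zipWith _,_ at-p at-S))
  in  ρ′ N , eqPart-interpolate (weight N) φ ρ⊨eq σ⊨eq , ρ′⊨lt , ρ′⊨p ∷ ρ′⊨S
  where
  open Weights (weights p-prime S-primes p∉S)
  ρ′ : ℕ → Assignment
  ρ′ n = interpolate ρ σ (weight n)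
  lt : Eventually (λ n → ρ′ n ⊨ ltPart φ)
  lt = ltPart-eventually {weight} weight→0 ρ σ φ ρ⊨lt
  at-p : Eventually (λ n → ρ′ n ⊨ pPart p φ)
  at-p = pPart-eventually p-prime {λ n → 1ℚ ℚ.- weight n} weight→1-at-p
    {σ} {ρ′} {λ t → eval ρ t ℚ.- eval σ t} ρ′≡σ+[1-w]Δ φ σ⊨p
    where
    ρ′≡σ+[1-w]Δ : ∀ n t → eval (ρ′ n) t ≡ eval σ t ℚ.+ (1ℚ ℚ.- weight n) ℚ.* (eval ρ t ℚ.- eval σ t)
    ρ′≡σ+[1-w]Δ n t = trans (eval-interpolate ρ σ (weight n) t) (interpolate-swap (weight n) (eval ρ t) (eval σ t))
  at-S : Eventually (λ n → All (λ q → ρ′ n ⊨ pPart q φ) S)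
  at-S = eventually-All (All.tabulate λ q∈S →
    pPart-eventually (All.lookup S-primes q∈S) {weight} (All.lookup weight→0-at-S q∈S)
      {ρ} {ρ′} {λ t → eval σ t ℚ.- eval ρ t} (λ n → eval-interpolate ρ σ (weight n))
      φ (All.lookup ρ⊨S q∈S))

satisfy-primes : ∀ φ → Satisfiable (eqPart φ ++ ltPart φ) →
                 (∀ p → Prime p → Satisfiable (eqPart φ ++ pPart p φ)) →
                 ∀ {S} → All Prime S → ∃[ ρ ] ρ ⊨⟨ S ⟩ φ
satisfy-primes φ (ρ , ρ⊨) _ [] = ρ , ++⁻ˡ (eqPart φ) ρ⊨ , ++⁻ʳ (eqPart φ) ρ⊨ , []
satisfy-primes φ sat-< sat-p {p ∷ S} (p-prime ∷ S-primes)
  with satisfy-primes φ sat-< sat-p S-primes | p ∈? S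
... | ρ , ρ⊨eq , ρ⊨lt , ρ⊨S | yes p∈S = ρ , ρ⊨eq , ρ⊨lt , All.lookup ρ⊨S p∈S ∷ ρ⊨S
... | ρ , ρ⊨                 | no  p∉S =
  let σ , σ⊨ = sat-p p p-prime
  in  add-prime φ p-prime S-primes p∉S ρ⊨ (++⁻ˡ (eqPart φ) σ⊨) (++⁻ʳ (eqPart φ) σ⊨)

proposition6p2 : (φ : Conj) →
    Satisfiable φ ⇔
      (Satisfiable (eqPart φ ++ ltPart φ) ×
       ((p : ℕ) → Prime p → Satisfiable (eqPart φ ++ pPart p φ)))
proposition6p2 φ = mk⇔
  (λ (ρ , ρ⊨φ) →
     (ρ , ++⁺ (All-resp-⊆ (eqPart-⊆ φ) ρ⊨φ) (All-resp-⊆ (ltPart-⊆ φ) ρ⊨φ)) ,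
     λ p _ → ρ , ++⁺ (All-resp-⊆ (eqPart-⊆ φ) ρ⊨φ) (All-resp-⊆ (pPart-⊆ p φ) ρ⊨φ))
  (λ (sat-< , sat-p) →
     let ρ , ρ⊨ = satisfy-primes φ sat-< sat-p (primesOf-prime φ)
     in  ρ , ⊨⟨primesOf⟩⇒⊨ φ ρ⊨)
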